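{- There exists a proper directed temporal graph $\mathcal{G}=(V,E,\lambda)$ such that no simple directed temporal graph $\mathcal{H}$ on the vertex set $V$ has a non-strict reachability graph isomorphic to $\mathcal{R}(\mathcal{G})$. In other words, some graph in the setting D \& proper has no reachability equivalent graph in the setting D \& non-strict \& simple.
   Context: A directed temporal graph is a triple $\mathcal{G}=(V,E,\lambda)$ with $V$ a finite vertex set, $E\subseteq\{(u,v)\in V\times V: u\ne v\}$ a set of arcs, and $\lambda\colon E\to 2^{\mathbb{N}}\setminus\{\emptyset\}$ assigning to each arc a nonempty finite set of time labels. $\mathcal{G}$ is simple if $|\lambda(e)|=1$ for all $e$, and proper if no two distinct arcs incident to a common vertex share a time label. A temporal path from $u$ to $v$ is a sequence $(e_1,t_1),\dots,(e_k,t_k)$, $k\ge1$, with $t_i\in\lambda(e_i)$, such that $e_1,\dots,e_k$ form a directed path from $u$ to $v$ in $(V,E)$ (distinct vertices) and $t_1\le\dots\le t_k$ (non-strict reachability uses all such paths; in a proper graph all such paths have strictly increasing labels). The reachability graph $\mathcal{R}(\mathcal{G})$ is the static directed graph on $V$ with an arc $(u,v)$, $u\ne v$, iff there is a temporal path from $u$ to $v$. Two temporal graphs on the same vertex set are reachability equivalent if their reachability graphs are isomorphic. -}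

module Defs where

open import Data.Nat using (ℕ; _≤_)
open import Data.Fin using (Fin)
open import Data.List using (List; []; _∷_)
open import Data.List.Membership.Propositional using (_∈_)
open import Data.List.Relation.Unary.Unique.Propositional using (Unique)
open import Data.Maybe using (Maybe; just; nothing)
open import Data.Product using (_×_; ∃; ∃-syntax; _,_)
open import Data.Sum using (_⊎_)
open import Data.Empty using (⊥)
open import Relation.Nullary using (¬_)
open import Relation.Binary.PropositionalEquality using (_≡_; _≢_; refl)
open import Function.Bundles using (_↔_; Inverse; _⇔_)

-- A directed temporal graph on vertex set V = Fin n.
-- labels u v is the (finite) set of time labels of the arc (u , v), given as a list;
-- (u , v) ∈ E  iff  labels u v is nonempty.
record TGraph (n : ℕ) : Set where
  field
    labels  : Fin n → Fin n → List ℕ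
    noLoops : ∀ u → labels u u ≡ []
open TGraph public

-- A simple directed temporal graph: every arc carries exactly one label.
-- label u v = just t  means (u , v) ∈ E with λ(u , v) = {t}.
record SimpleTGraph (n : ℕ) : Set where
  field
    label   : Fin n → Fin n → Maybe ℕ
    noLoops : ∀ u → label u u ≡ nothing
open SimpleTGraph public

maybeToList : Maybe ℕ → List ℕ
maybeToList nothing  = []
maybeToList (just t) = t ∷ []

maybeToList-nothing : ∀ {x : Maybe ℕ} → x ≡ nothing → maybeToList x ≡ []
maybeToList-nothing refl = refl

toTGraph : ∀ {n} → SimpleTGraph n → TGraph n
toTGraph H = record
  { labels  = λ u v → maybeToList (label H u v)
  ; noLoops = λ u → maybeToList-nothing (SimpleTGraph.noLoops H u) }

ShareVertex : ∀ {n} → Fin n → Fin n → Fin n → Fin n → Set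
ShareVertex a b c d = a ≡ c ⊎ a ≡ d ⊎ b ≡ c ⊎ b ≡ d

Proper : ∀ {n} → TGraph n → Set
Proper {n} G = ∀ (a b c d : Fin n) (t : ℕ) →
  t ∈ labels G a b → t ∈ labels G c d →
  ¬ ((a ≡ c) × (b ≡ d)) → ShareVertex a b c d → ⊥

-- TWalk G u v t vs : a sequence of time-labelled arcs (e₁,t₁),…,(e_k,t_k), k ≥ 1,
-- from u to v, with non-decreasing labels, whose first label is t and whose
-- sequence of visited vertices is vs.
data TWalk {n : ℕ} (G : TGraph n) : Fin n → Fin n → ℕ → List (Fin n) → Set where
  one  : ∀ {u v t} → t ∈ labels G u v → TWalk G u v t (u ∷ v ∷ [])
  cons : ∀ {u w v t t' vs} → t ∈ labels G u w → t ≤ t' →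
         TWalk G w v t' vs → TWalk G u v t (u ∷ vs)

TemporalPath : ∀ {n} → TGraph n → Fin n → Fin n → Set
TemporalPath G u v = ∃[ t ] ∃[ vs ] (TWalk G u v t vs × Unique vs)

Reach : ∀ {n} → TGraph n → Fin n → Fin n → Set
Reach G u v = u ≢ v × TemporalPath G u v

Isomorphic : ∀ {n} → (Fin n → Fin n → Set) → (Fin n → Fin n → Set) → Set
Isomorphic {n} R S =
  ∃ λ (f : Fin n ↔ Fin n) → ∀ u v → R u v ⇔ S (Inverse.to f u) (Inverse.to f v)

ReachEquivalent : ∀ {n} → TGraph n → TGraph n → Set
ReachEquivalent G H = Isomorphic (Reach G) (Reach H)

-- The proper graph is the directed 4-cycle 0 → 1 → 2 → 3 → 0 whose arc 2 → 3 carries an early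
-- label, used by the journey 2 → 3 → 0, and a late one, used by 1 → 2 → 3. A simple graph with the
-- same reachability graph must contain the four cycle arcs, with single labels a, b, c, d, and no
-- chords: the journey realising 1 ↝ 3 gives b ≤ c, and the non-reachabilities 0 ↛ 2, 3 ↛ 1 and
-- 1 ↛ 0 then give b < a < d < c. But the journey realising 2 ↝ 0 must be 2 → 3 → 0, so c ≤ d.
module Submission where

open import Defs
open import Data.Nat using (ℕ; _≤_; _<_; _≤?_; z≤n; s≤s)
open import Data.Nat.Properties using (≤-refl; <⇒≤; <⇒≱; ≰⇒>; <-trans)
open import Data.Fin using (Fin; _≟_)
open import Data.Fin.Patterns using (0F; 1F; 2F; 3F)
open import Data.List using (List; []; _∷_; map)
open import Data.List.Membership.Propositional using (_∈_)
open import Data.List.Relation.Unary.Any using (here; there)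
open import Data.List.Relation.Unary.All as All using ([]; _∷_)
open import Data.List.Relation.Unary.AllPairs using ([]; _∷_)
open import Data.List.Relation.Unary.Unique.Propositional using (Unique)
open import Data.List.Relation.Unary.Unique.Propositional.Properties using (map⁺)
open import Data.List.Relation.Unary.Unique.DecPropositional using (unique?)
open import Data.Maybe using (just)
open import Data.Maybe.Properties using (just-injective)
open import Data.Product using (∃; ∃-syntax; ∃₂; _×_; _,_; proj₂)
open import Data.Empty using (⊥; ⊥-elim)
open import Relation.Nullary using (¬_; contradiction; yes; no)
open import Relation.Nullary.Decidable using (True; toWitness)
open import Relation.Binary.PropositionalEquality using (_≡_; _≢_; refl; sym; trans; subst; subst₂)
open import Function using (id)
open import Function.Bundles using (_↔_; Inverse; Injection; _⇔_; Equivalence; mk⇔)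
open import Function.Properties.Inverse using (↔-sym; ↔⇒↣)
import Function.Properties.Equivalence as ⇔

module _ {n : ℕ} {G : TGraph n} where

  departure : ∀ {u v t vs} → TWalk G u v t vs → ∃[ w ] t ∈ labels G u w
  departure (one m)      = _ , m
  departure (cons m _ _) = _ , m

  target∈ : ∀ {u v t vs} → TWalk G u v t vs → v ∈ vs
  target∈ (one _)      = there (here refl)
  target∈ (cons _ _ W) = there (target∈ W)

  endpoints-distinct : ∀ {u v t vs} → TWalk G u v t vs → Unique vs → u ≢ v
  endpoints-distinct (one _)      ((u≢v ∷ []) ∷ _) = u≢v
  endpoints-distinct (cons _ _ W) (u∉ ∷ _)         = All.lookup u∉ (target∈ W)

  path⇒reach : ∀ {u v} → TemporalPath G u v → Reach G u v
  path⇒reach p@(_ , _ , W , U) = endpoints-distinct W U , p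

  -- For a concrete vertex list the distinctness proof is found by computation.
  walk⇒reach : ∀ {u v t vs} → TWalk G u v t vs → {True (unique? _≟_ vs)} → Reach G u v
  walk⇒reach W {distinct} = path⇒reach (_ , _ , W , toWitness distinct)

module _ {n m : ℕ} {G : TGraph n} {G′ : TGraph m}
         (h : Fin n → Fin m) (h-injective : ∀ {x y} → h x ≡ h y → x ≡ y)
         (h-labels : ∀ {u w t} → t ∈ labels G u w → t ∈ labels G′ (h u) (h w)) where

  map-walk : ∀ {u v t vs} → TWalk G u v t vs → TWalk G′ (h u) (h v) t (map h vs)
  map-walk (one m)       = one (h-labels m)
  map-walk (cons m le W) = cons (h-labels m) le (map-walk W)

  map-reach : ∀ {u v} → Reach G u v → Reach G′ (h u) (h v)
  map-reach (_ , _ , _ , W , U) = path⇒reach (_ , _ , map-walk W , map⁺ h-injective U)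

module _ {n : ℕ} (H : SimpleTGraph n) where

  Arc : Fin n → Fin n → ℕ → Set
  Arc u w t = label H u w ≡ just t

  ∈⇒Arc : ∀ {u w t} → t ∈ labels (toTGraph H) u w → Arc u w t
  ∈⇒Arc {u} {w} m with label H u w
  ∈⇒Arc (here refl) | just _ = refl

  Arc⇒∈ : ∀ {u w t} → Arc u w t → t ∈ labels (toTGraph H) u w
  Arc⇒∈ {u} {w} a with label H u w
  Arc⇒∈ refl | just _ = here refl

  Arc-functional : ∀ {u w t s} → Arc u w t → Arc u w s → t ≡ s
  Arc-functional p q = just-injective (trans (sym p) q)

  Arc-irreflexive : ∀ {u w t} → Arc u w t → u ≢ w
  Arc-irreflexive {u} a refl with trans (sym a) (SimpleTGraph.noLoops H u)
  ... | ()

  Arc⇒reach : ∀ {u w t} → Arc u w t → Reach (toTGraph H) u w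
  Arc⇒reach a = path⇒reach (_ , _ , one (Arc⇒∈ a) , (Arc-irreflexive a ∷ []) ∷ [] ∷ [])

  walk₂ : ∀ {u w x t s} → Arc u w t → Arc w x s → t ≤ s →
          TWalk (toTGraph H) u x t (u ∷ w ∷ x ∷ [])
  walk₂ a b t≤s = cons (Arc⇒∈ a) t≤s (one (Arc⇒∈ b))

  walk₃ : ∀ {u w x y t s r} → Arc u w t → Arc w x s → Arc x y r → t ≤ s → s ≤ r →
          TWalk (toTGraph H) u y t (u ∷ w ∷ x ∷ y ∷ [])
  walk₃ a b c t≤s s≤r = cons (Arc⇒∈ a) t≤s (walk₂ b c s≤r)

relabel : ∀ {n} → Fin n ↔ Fin n → SimpleTGraph n → SimpleTGraph n
relabel f H = record
  { label   = λ x y → label H (from x) (from y)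
  ; noLoops = λ x → SimpleTGraph.noLoops H (from x)
  }
  where open Inverse f

relabel-reach : ∀ {n} (f : Fin n ↔ Fin n) (H : SimpleTGraph n) x y →
  Reach (toTGraph (relabel f H)) x y ⇔ Reach (toTGraph H) (Inverse.from f x) (Inverse.from f y)
relabel-reach f H x y = mk⇔
  (map-reach from (Injection.injective (↔⇒↣ (↔-sym f))) id)
  (λ r → subst₂ (Reach _) (strictlyInverseˡ x) (strictlyInverseˡ y)
           (map-reach to (Injection.injective (↔⇒↣ f)) to-labels r))
  where
  open Inverse f
  to-labels : ∀ {u w t} → t ∈ labels (toTGraph H) u w →
              t ∈ labels (toTGraph (relabel f H)) (to u) (to w)
  to-labels {u} {w} {t} =
    subst₂ (λ u′ w′ → t ∈ labels (toTGraph H) u′ w′) (sym (strictlyInverseʳ u)) (sym (strictlyInverseʳ w))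

aligned-relabelling : ∀ {n} (H : SimpleTGraph n) (G : TGraph n) → ReachEquivalent (toTGraph H) G →
  ∃ λ H′ → ∀ x y → Reach (toTGraph H′) x y ⇔ Reach G x y
aligned-relabelling H G (f , iso) = relabel f H , λ x y →
  ⇔.trans (relabel-reach f H x y)
    (subst₂ (λ x′ y′ → _ ⇔ Reach G x′ y′) (strictlyInverseˡ x) (strictlyInverseˡ y)
      (iso (from x) (from y)))
  where open Inverse f

DisjointLabels : ∀ {n} → TGraph n → Set
DisjointLabels G = ∀ {a b c d t} → t ∈ labels G a b → t ∈ labels G c d → (a ≡ c) × (b ≡ d)

disjoint⇒proper : ∀ {n} {G : TGraph n} → DisjointLabels G → Proper G
disjoint⇒proper disjoint _ _ _ _ _ p q distinct _ = distinct (disjoint p q)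

C₄-labels : Fin 4 → Fin 4 → List ℕ
C₄-labels 0F 1F = 3 ∷ []
C₄-labels 1F 2F = 2 ∷ []
C₄-labels 2F 3F = 1 ∷ 5 ∷ []
C₄-labels 3F 0F = 4 ∷ []
C₄-labels _  _  = []

C₄ : TGraph 4
C₄ = record
  { labels  = C₄-labels
  ; noLoops = λ { 0F → refl ; 1F → refl ; 2F → refl ; 3F → refl }
  }

data C₄-Arc : Fin 4 → Fin 4 → ℕ → Set where
  0→1  : C₄-Arc 0F 1F 3
  1→2  : C₄-Arc 1F 2F 2
  2→3ᵉ : C₄-Arc 2F 3F 1
  2→3ˡ : C₄-Arc 2F 3F 5
  3→0  : C₄-Arc 3F 0F 4

C₄-arc : ∀ {u w t} → t ∈ labels C₄ u w → C₄-Arc u w t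
C₄-arc {0F} {1F} (here refl)         = 0→1
C₄-arc {1F} {2F} (here refl)         = 1→2
C₄-arc {2F} {3F} (here refl)         = 2→3ᵉ
C₄-arc {2F} {3F} (there (here refl)) = 2→3ˡ
C₄-arc {3F} {0F} (here refl)         = 3→0
C₄-arc {0F} {1F} (there ())
C₄-arc {1F} {2F} (there ())
C₄-arc {2F} {3F} (there (there ()))
C₄-arc {3F} {0F} (there ())
C₄-arc {0F} {0F} ()
C₄-arc {0F} {2F} ()
C₄-arc {0F} {3F} ()
C₄-arc {1F} {0F} ()
C₄-arc {1F} {1F} ()
C₄-arc {1F} {3F} ()
C₄-arc {2F} {0F} ()
C₄-arc {2F} {1F} ()
C₄-arc {2F} {2F} ()
C₄-arc {3F} {1F} ()
C₄-arc {3F} {2F} ()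
C₄-arc {3F} {3F} ()

C₄-disjoint : DisjointLabels C₄
C₄-disjoint p q with C₄-arc p | C₄-arc q
... | 0→1  | 0→1  = refl , refl
... | 1→2  | 1→2  = refl , refl
... | 2→3ᵉ | 2→3ᵉ = refl , refl
... | 2→3ˡ | 2→3ˡ = refl , refl
... | 3→0  | 3→0  = refl , refl

C₄-lastDeparture : Fin 4 → ℕ
C₄-lastDeparture 0F = 3
C₄-lastDeparture 1F = 2
C₄-lastDeparture 2F = 5
C₄-lastDeparture 3F = 4

C₄-Arc-departs-by : ∀ {u w t} → C₄-Arc u w t → t ≤ C₄-lastDeparture u
C₄-Arc-departs-by 0→1  = ≤-refl
C₄-Arc-departs-by 1→2  = ≤-refl
C₄-Arc-departs-by 2→3ᵉ = s≤s z≤n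
C₄-Arc-departs-by 2→3ˡ = ≤-refl
C₄-Arc-departs-by 3→0  = ≤-refl

C₄-stalls : ∀ {u v t vs} → TWalk C₄ u v t vs → ¬ C₄-lastDeparture u < t
C₄-stalls W late = <⇒≱ late (C₄-Arc-departs-by (C₄-arc (proj₂ (departure W))))

data C₄-Reach : Fin 4 → Fin 4 → Set where
  0↝1 : C₄-Reach 0F 1F
  1↝2 : C₄-Reach 1F 2F
  1↝3 : C₄-Reach 1F 3F
  2↝3 : C₄-Reach 2F 3F
  2↝0 : C₄-Reach 2F 0F
  3↝0 : C₄-Reach 3F 0F

C₄-Arc-reach : ∀ {u w t} → C₄-Arc u w t → C₄-Reach u w
C₄-Arc-reach 0→1  = 0↝1
C₄-Arc-reach 1→2  = 1↝2
C₄-Arc-reach 2→3ᵉ = 2↝3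
C₄-Arc-reach 2→3ˡ = 2↝3
C₄-Arc-reach 3→0  = 3↝0

C₄-walk-from-3 : ∀ {v t vs} → TWalk C₄ 3F v t vs → v ≡ 0F
C₄-walk-from-3 (one m) with C₄-arc m
... | 3→0 = refl
C₄-walk-from-3 (cons m le W) with C₄-arc m
... | 3→0 = ⊥-elim (C₄-stalls W le)

C₄-late-walk-from-2 : ∀ {v t vs} → TWalk C₄ 2F v t vs → 2 ≤ t → v ≡ 3F
C₄-late-walk-from-2 (one m) _ with C₄-arc m
... | 2→3ᵉ = refl
... | 2→3ˡ = refl
C₄-late-walk-from-2 (cons m le W) 2≤t with C₄-arc m
... | 2→3ᵉ = contradiction 2≤t λ { (s≤s ()) }
... | 2→3ˡ = ⊥-elim (C₄-stalls W le)

C₄-walk-reach : ∀ {u v t vs} → TWalk C₄ u v t vs → C₄-Reach u v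
C₄-walk-reach (one m) = C₄-Arc-reach (C₄-arc m)
C₄-walk-reach (cons m le W) with C₄-arc m
... | 0→1  = ⊥-elim (C₄-stalls W le)
... | 1→2  rewrite C₄-late-walk-from-2 W le = 1↝3
... | 2→3ᵉ rewrite C₄-walk-from-3 W = 2↝0
... | 2→3ˡ rewrite C₄-walk-from-3 W = 2↝0
... | 3→0  = ⊥-elim (C₄-stalls W le)

C₄-reach-complete : ∀ {x y} → C₄-Reach x y → Reach C₄ x y
C₄-reach-complete 0↝1 = walk⇒reach (one (here refl))
C₄-reach-complete 1↝2 = walk⇒reach (one (here refl))
C₄-reach-complete 1↝3 = walk⇒reach (cons {w = 2F} (here refl) (s≤s (s≤s z≤n)) (one (there (here refl))))
C₄-reach-complete 2↝3 = walk⇒reach (one (here refl))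
C₄-reach-complete 2↝0 = walk⇒reach (cons {w = 3F} (here refl) (s≤s z≤n) (one (here refl)))
C₄-reach-complete 3↝0 = walk⇒reach (one (here refl))

C₄-reach : ∀ x y → Reach C₄ x y ⇔ C₄-Reach x y
C₄-reach x y = mk⇔ (λ (_ , _ , _ , W , _) → C₄-walk-reach W) C₄-reach-complete

module _ (H : SimpleTGraph 4) (reach⇔ : ∀ x y → Reach (toTGraph H) x y ⇔ C₄-Reach x y) where

  realised : ∀ {x y t vs} → TWalk (toTGraph H) x y t vs → {True (unique? _≟_ vs)} → C₄-Reach x y
  realised W {distinct} = Equivalence.to (reach⇔ _ _) (walk⇒reach W {distinct})

  Arc-realised : ∀ {x y t} → Arc H x y t → C₄-Reach x y
  Arc-realised a = Equivalence.to (reach⇔ _ _) (Arc⇒reach H a)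

  walk-realising : ∀ {x y} → C₄-Reach x y → ∃₂ λ t vs → TWalk (toTGraph H) x y t vs
  walk-realising r with Equivalence.from (reach⇔ _ _) r
  ... | _ , t , vs , W , _ = t , vs , W

  sole-successor-arc : ∀ {x y} → C₄-Reach x y → (∀ {w} → C₄-Reach x w → w ≡ y) → ∃[ t ] Arc H x y t
  sole-successor-arc r sole with walk-realising r
  ... | _ , _ , W with departure W
  ... | w , m = subst (λ w′ → ∃[ t ] Arc H _ w′ _) (sole (Arc-realised (∈⇒Arc H m))) (_ , ∈⇒Arc H m)

  module _ {a d} (a₀₁ : Arc H 0F 1F a) (d₃₀ : Arc H 3F 0F d) where

    a<d : a < d
    a<d = ≰⇒> λ d≤a → contradiction (realised (walk₂ H d₃₀ a₀₁ d≤a)) λ ()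

    no-arc-1→3 : ∀ {t} → ¬ Arc H 1F 3F t
    no-arc-1→3 {t} e with a ≤? t
    ... | yes a≤t = contradiction (realised (walk₂ H a₀₁ e a≤t)) λ ()
    ... | no  a≰t = contradiction (realised (walk₂ H e d₃₀ (<⇒≤ (<-trans (≰⇒> a≰t) a<d)))) λ ()

    arcs-1→2→3 : ∃₂ λ b c → Arc H 1F 2F b × Arc H 2F 3F c × b ≤ c
    arcs-1→2→3 with walk-realising 1↝3
    ... | _ , _ , one m = ⊥-elim (no-arc-1→3 (∈⇒Arc H m))
    ... | _ , _ , cons m le W with Arc-realised (∈⇒Arc H m)
    ...   | 1↝3 = ⊥-elim (no-arc-1→3 (∈⇒Arc H m))
    ...   | 1↝2 with departure W
    ...     | _ , m′ with Arc-realised (∈⇒Arc H m′)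
    ...       | 2↝3 = _ , _ , ∈⇒Arc H m , ∈⇒Arc H m′ , le
    ...       | 2↝0 = contradiction (realised (walk₂ H (∈⇒Arc H m) (∈⇒Arc H m′) le)) λ ()

    module _ {b c} (b₁₂ : Arc H 1F 2F b) (c₂₃ : Arc H 2F 3F c) (b≤c : b ≤ c) where

      b<a : b < a
      b<a = ≰⇒> λ a≤b → contradiction (realised (walk₂ H a₀₁ b₁₂ a≤b)) λ ()

      d<c : d < c
      d<c = ≰⇒> λ c≤d → contradiction (realised (walk₃ H b₁₂ c₂₃ d₃₀ b≤c c≤d)) λ ()

      no-arc-2→0 : ∀ {t} → ¬ Arc H 2F 0F t
      no-arc-2→0 {t} e with t ≤? a
      ... | yes t≤a = contradiction (realised (walk₂ H e a₀₁ t≤a)) λ ()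
      ... | no  t≰a = contradiction (realised (walk₂ H b₁₂ e (<⇒≤ (<-trans b<a (≰⇒> t≰a))))) λ ()

      c≤d : c ≤ d
      c≤d with walk-realising 2↝0
      ... | _ , _ , one m = ⊥-elim (no-arc-2→0 (∈⇒Arc H m))
      ... | _ , _ , cons m le W with Arc-realised (∈⇒Arc H m)
      ...   | 2↝0 = ⊥-elim (no-arc-2→0 (∈⇒Arc H m))
      ...   | 2↝3 with departure W
      ...     | _ , m′ with Arc-realised (∈⇒Arc H m′)
      ...       | 3↝0 = subst₂ _≤_ (Arc-functional H (∈⇒Arc H m) c₂₃) (Arc-functional H (∈⇒Arc H m′) d₃₀) le

  C₄-unrealisable : ⊥
  C₄-unrealisable with sole-successor-arc 0↝1 (λ { 0↝1 → refl }) | sole-successor-arc 3↝0 (λ { 3↝0 → refl })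
  ... | _ , a₀₁ | _ , d₃₀ with arcs-1→2→3 a₀₁ d₃₀
  ... | _ , _ , b₁₂ , c₂₃ , b≤c = <⇒≱ (d<c a₀₁ d₃₀ b₁₂ c₂₃ b≤c) (c≤d a₀₁ d₃₀ b₁₂ c₂₃ b≤c)

lemma9 : ∃[ n ] ∃ λ (G : TGraph n) →
    Proper G × (∀ (H : SimpleTGraph n) → ¬ ReachEquivalent (toTGraph H) G)
lemma9 = 4 , C₄ , disjoint⇒proper {G = C₄} C₄-disjoint , λ H equivalent →
  let H′ , H′-reach = aligned-relabelling H C₄ equivalent
  in C₄-unrealisable H′ (λ x y → ⇔.trans (H′-reach x y) (C₄-reach x y))
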